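{- Let ${\cal D}$ be a $k$-GDD of type $g^u$ with $v=ug$ points, and let $c\ge 2$ be an integer. If $v\ge c\ge u$, or if $k=u$, then there exists a block-equitable $c$-colouring of ${\cal D}$.
   Context: A group divisible design (GDD) is a triple $(V,{\cal G},{\cal B})$ where $V$ is a finite set of points, ${\cal G}$ is a partition of $V$ into groups, and ${\cal B}$ is a collection of subsets of $V$ (blocks) such that every pair of distinct points lies either in exactly one block or in exactly one group, but not both. A $k$-GDD of type $g^u$ has all blocks of size $k$ and exactly $u$ groups, each of size $g$. A $c$-colouring is a function $f:V\to{\cal C}$ with $|{\cal C}|=c$, with colour classes $F(\gamma)=f^{ -1}(\gamma)$. It is block-equitable if $\lfloor k/c\rfloor\le |B\cap F(\gamma)|\le\lceil k/c\rceil$ for every colour $\gamma$ and every block $B$. -}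

module Defs where

open import Data.Nat using (ℕ; zero; suc; _+_; _*_; _∸_; _≤_; NonZero)
open import Data.Nat.DivMod using (_/_)
open import Data.Fin using (Fin)
open import Data.Fin.Properties using () renaming (_≟_ to _≟ᶠ_)
open import Data.Fin.Subset using (Subset; _∈_; ∣_∣; _∩_)
open import Data.Vec using (tabulate)
open import Data.List using (List; filter; length)
open import Data.List.Membership.Propositional renaming (_∈_ to _∈ˡ_)
open import Data.Product using (_×_)
open import Data.Sum using (_⊎_)
open import Relation.Nullary using (¬_; does)
open import Relation.Binary.PropositionalEquality using (_≡_)
open import Data.Fin.Subset.Properties using (_∈?_)
open import Relation.Nullary.Decidable using (_×-dec_)

blocksThrough : ∀ {v} → List (Subset v) → Fin v → Fin v → ℕ
blocksThrough Bs x y = length (filter (λ B → (x ∈? B) ×-dec (y ∈? B)) Bs)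

fibre : ∀ {v n} → (Fin v → Fin n) → Fin n → Subset v
fibre f a = tabulate (λ x → does (f x ≟ᶠ a))

-- A k-GDD of type g^u: point set V = Fin (u * g); the partition into u groups
-- is given by a map `grp` to Fin u (group i = grp⁻¹ i), each group of size g;
-- blocks are a list (multiset) of subsets, each of size k; every pair of distinct
-- points lies in a common group and in no block, or in different groups and in
-- exactly one block.
record GDD (k g u : ℕ) : Set where
  field
    grp       : Fin (u * g) → Fin u
    grpSize   : ∀ (i : Fin u) → ∣ fibre grp i ∣ ≡ g
    blocks    : List (Subset (u * g))
    blockSize : ∀ B → B ∈ˡ blocks → ∣ B ∣ ≡ k
    pairs     : ∀ (x y : Fin (u * g)) → ¬ (x ≡ y) →
                  (grp x ≡ grp y × blocksThrough blocks x y ≡ 0)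
                ⊎ (¬ (grp x ≡ grp y) × blocksThrough blocks x y ≡ 1)

⌈_/_⌉ : (a c : ℕ) → .{{NonZero c}} → ℕ
⌈ a / c ⌉ = (a + (c ∸ 1)) / c

BlockEquitable : ∀ {k g u} (D : GDD k g u) (c : ℕ) .{{_ : NonZero c}} →
                 (Fin (u * g) → Fin c) → Set
BlockEquitable {k} D c f =
  ∀ B → B ∈ˡ GDD.blocks D → ∀ (γ : Fin c) →
    (k / c ≤ ∣ B ∩ fibre f γ ∣) × (∣ B ∩ fibre f γ ∣ ≤ ⌈ k / c ⌉)

-- Colour every point of group i with colour i mod c. The points of a block lie in
-- distinct groups. If u ≤ c the colours of the points of a block are distinct, so each
-- colour occurs at most once in a block, which is equitable as long as k < c; and
-- k ≥ c is only possible when k = u. If k = u, a block meets every group exactly once,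
-- so colour γ occurs in it as often as γ occurs among the residues of 0, …, u − 1
-- modulo c, namely ⌊u/c⌋ or ⌈u/c⌉ times.
module Submission where

open import Defs
open import Data.Bool.Base using (Bool; true; false)
open import Data.Empty using (⊥-elim)
open import Data.Fin.Base using (Fin; zero; suc; toℕ)
open import Data.Fin.Properties using (toℕ-injective; toℕ<n; toℕ-fromℕ<; fromℕ<-cong)
  renaming (_≟_ to _≟ᶠ_)
open import Data.Fin.Subset using (Subset; inside; outside; _∈_; _∩_; ∣_∣; ⁅_⁆; ⊤)
open import Data.Fin.Subset.Properties
  using (_∈?_; nonempty?; Empty-unique; x∈⁅x⁆; x∈⁅y⁆⇒x≡y; ⊆-antisym; x∈p∩q⁻; ∩-identityʳ;
         ∣⊥∣≡0; ∣⁅x⁆∣≡1; ∣p∩q∣≤∣p∣)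
open import Data.List.Membership.Propositional using () renaming (_∈_ to _∈ˡ_)
open import Data.List.Membership.Propositional.Properties using (∈-filter⁺; ∈-length)
open import Data.Nat.Base using (ℕ; zero; suc; _+_; _*_; _∸_; _≤_; _<_; z≤n; s≤s; NonZero; >-nonZero⁻¹)
open import Data.Nat.DivMod
  using (_/_; _%_; _mod_; m≡m%n+[m/n]*n; m%n<n; m%n≤n; m<n⇒m%n≡m; m<n⇒m/n≡0; m*n/n≡m;
         %-remove-+ˡ; /-monoˡ-≤)
open import Data.Nat.Divisibility using (∣-refl)
open import Data.Nat.Properties
  using (+-*-semiring; _<?_; +-assoc; +-comm; +-identityʳ; *-comm; *-identityˡ; *-identityʳ;
         *-zeroʳ; *-distribˡ-+; ≤-reflexive; ≤-trans; ≤-antisym; <-irrefl; ≮⇒≥; m≤m+n;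
         +-mono-≤; +-monoˡ-≤; +-monoʳ-≤; +-cancelʳ-≤; m∸n+n≡m; module ≤-Reasoning)
open import Algebra.Properties.Semiring.Sum +-*-semiring
  using (sum; sum-syntax; sum-cong-≗; sum-remove; sum-replicate-zero; ∑-distrib-+)
open import Data.Product using (_×_; _,_; Σ)
open import Data.Sum using (_⊎_; inj₁; inj₂)
open import Data.Vec.Base using (_∷_; [])
open import Data.Vec.Functional using (removeAt)
open import Data.Vec.Properties using (lookup∘tabulate; lookup⇒[]=; []=⇒lookup)
open import Function.Base using (_∘_)
open import Relation.Nullary using (does; yes; no)
open import Relation.Nullary.Decidable using (dec-true; _×-dec_)
open import Relation.Binary.PropositionalEquality

𝟙 : Bool → ℕ
𝟙 true  = 1
𝟙 false = 0

δ : ∀ {m} → Fin m → Fin m → ℕ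
δ i j = 𝟙 (does (i ≟ᶠ j))

∣b∷p∣≡𝟙b+∣p∣ : ∀ {n} b (p : Subset n) → ∣ b ∷ p ∣ ≡ 𝟙 b + ∣ p ∣
∣b∷p∣≡𝟙b+∣p∣ true  p = refl
∣b∷p∣≡𝟙b+∣p∣ false p = refl

∣fibre∣≡∑ : ∀ {n m} (f : Fin n → Fin m) γ → ∣ fibre f γ ∣ ≡ ∑[ i < n ] δ (f i) γ
∣fibre∣≡∑ {zero}  f γ = refl
∣fibre∣≡∑ {suc n} f γ = trans (∣b∷p∣≡𝟙b+∣p∣ (does (f zero ≟ᶠ γ)) (fibre (f ∘ suc) γ))
                              (cong (δ (f zero) γ +_) (∣fibre∣≡∑ (f ∘ suc) γ))

∈-fibre⁺ : ∀ {n m} {f : Fin n → Fin m} {γ x} → f x ≡ γ → x ∈ fibre f γ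
∈-fibre⁺ {f = f} {γ} {x} fx≡γ =
  lookup⇒[]= x _ (trans (lookup∘tabulate _ x) (dec-true (f x ≟ᶠ γ) fx≡γ))

∈-fibre⁻ : ∀ {n m} {f : Fin n → Fin m} {γ x} → x ∈ fibre f γ → f x ≡ γ
∈-fibre⁻ {f = f} {γ} {x} x∈fibre
  with f x ≟ᶠ γ | trans (sym (lookup∘tabulate _ x)) ([]=⇒lookup x∈fibre)
... | yes fx≡γ | _ = fx≡γ
... | no _     | ()

∣p∣≡1 : ∀ {n} {p : Subset n} {x} → x ∈ p → (∀ {y} → y ∈ p → y ≡ x) → ∣ p ∣ ≡ 1
∣p∣≡1 {p = p} {x} x∈p unique = trans (cong ∣_∣ (⊆-antisym p⊆⁅x⁆ ⁅x⁆⊆p)) (∣⁅x⁆∣≡1 x)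
  where
  p⊆⁅x⁆ : ∀ {y} → y ∈ p → y ∈ ⁅ x ⁆
  p⊆⁅x⁆ y∈p = subst (_∈ ⁅ x ⁆) (sym (unique y∈p)) (x∈⁅x⁆ x)
  ⁅x⁆⊆p : ∀ {y} → y ∈ ⁅ x ⁆ → y ∈ p
  ⁅x⁆⊆p y∈⁅x⁆ = subst (_∈ p) (sym (x∈⁅y⁆⇒x≡y x y∈⁅x⁆)) x∈p

∣p∣≤1 : ∀ {n} {p : Subset n} → (∀ {x y} → x ∈ p → y ∈ p → x ≡ y) → ∣ p ∣ ≤ 1
∣p∣≤1 {n} {p} all-equal with nonempty? p
... | yes (x , x∈p) = ≤-reflexive (∣p∣≡1 x∈p (λ y∈p → all-equal y∈p x∈p))
... | no  p-empty   = ≤-trans (≤-reflexive (trans (cong ∣_∣ (Empty-unique p-empty)) (∣⊥∣≡0 n))) z≤n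

∣p∩fibre∣≤1 : ∀ {n m} {p : Subset n} {f : Fin n → Fin m} →
              (∀ {x y} → x ∈ p → y ∈ p → f x ≡ f y → x ≡ y) → ∀ γ → ∣ p ∩ fibre f γ ∣ ≤ 1
∣p∩fibre∣≤1 {p = p} {f} injective γ = ∣p∣≤1 λ {x} {y} x∈ y∈ →
  let (x∈p , x∈fibre) = x∈p∩q⁻ p (fibre f γ) x∈
      (y∈p , y∈fibre) = x∈p∩q⁻ p (fibre f γ) y∈
  in injective x∈p y∈p (trans (∈-fibre⁻ {f = f} x∈fibre) (sym (∈-fibre⁻ {f = f} y∈fibre)))

∑-δ : ∀ {m} (j : Fin m) (G : Fin m → ℕ) → ∑[ i < m ] (δ j i * G i) ≡ G j
∑-δ {suc m} zero    G =
  trans (cong₂ _+_ (+-identityʳ (G zero)) (sum-replicate-zero m)) (+-identityʳ (G zero))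
∑-δ {suc m} (suc j) G = ∑-δ j (G ∘ suc)

∑≤n : ∀ {n} (f : Fin n → ℕ) → (∀ i → f i ≤ 1) → ∑[ i < n ] f i ≤ n
∑≤n {zero}  f f≤1 = z≤n
∑≤n {suc n} f f≤1 = +-mono-≤ (f≤1 zero) (∑≤n (f ∘ suc) (f≤1 ∘ suc))

∑≡n⇒≡1 : ∀ {n} (f : Fin n → ℕ) → (∀ i → f i ≤ 1) → ∑[ i < n ] f i ≡ n → ∀ i → f i ≡ 1
∑≡n⇒≡1 {suc n} f f≤1 ∑f≡n i = ≤-antisym (f≤1 i) (+-cancelʳ-≤ n 1 (f i) (begin
  suc n                   ≡⟨ sym ∑f≡n ⟩
  ∑[ j < suc n ] f j      ≡⟨ sum-remove {i = i} f ⟩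
  f i + sum (removeAt f i) ≤⟨ +-monoʳ-≤ (f i) (∑≤n (removeAt f i) (λ j → f≤1 _)) ⟩
  f i + n                 ∎))
  where open ≤-Reasoning

∑-toℕ-+ : ∀ a {b} (h : ℕ → ℕ) →
          ∑[ i < a + b ] h (toℕ i) ≡ ∑[ i < a ] h (toℕ i) + ∑[ j < b ] h (a + toℕ j)
∑-toℕ-+ zero    h = refl
∑-toℕ-+ (suc a) h = trans (cong (h 0 +_) (∑-toℕ-+ a (h ∘ suc))) (sym (+-assoc (h 0) _ _))

∣p∩fibre[f∘h]∣≡∑ : ∀ {n m l} (p : Subset n) (h : Fin n → Fin m) (f : Fin m → Fin l) γ →
  ∣ p ∩ fibre (f ∘ h) γ ∣ ≡ ∑[ i < m ] (δ (f i) γ * ∣ p ∩ fibre h i ∣)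
∣p∩fibre[f∘h]∣≡∑ {m = m} [] h f γ =
  trans (sym (sum-replicate-zero m)) (sum-cong-≗ (λ i → sym (*-zeroʳ (δ (f i) γ))))
∣p∩fibre[f∘h]∣≡∑ (outside ∷ p) h f γ = ∣p∩fibre[f∘h]∣≡∑ p (h ∘ suc) f γ
∣p∩fibre[f∘h]∣≡∑ {m = m} (inside ∷ p) h f γ = begin
  ∣ does (f (h zero) ≟ᶠ γ) ∷ (p ∩ fibre (f ∘ h ∘ suc) γ) ∣
    ≡⟨ ∣b∷p∣≡𝟙b+∣p∣ (does (f (h zero) ≟ᶠ γ)) (p ∩ fibre (f ∘ h ∘ suc) γ) ⟩
  δ (f (h zero)) γ + ∣ p ∩ fibre (f ∘ h ∘ suc) γ ∣
    ≡⟨ cong₂ _+_ (sym (∑-δ (h zero) χ)) (∣p∩fibre[f∘h]∣≡∑ p (h ∘ suc) f γ) ⟩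
  ∑[ i < m ] (δ (h zero) i * χ i) + ∑[ i < m ] (χ i * ∣ q i ∣)
    ≡⟨ sym (∑-distrib-+ (λ i → δ (h zero) i * χ i) (λ i → χ i * ∣ q i ∣)) ⟩
  ∑[ i < m ] (δ (h zero) i * χ i + χ i * ∣ q i ∣)
    ≡⟨ sum-cong-≗ (λ i → distribute (δ (h zero) i) (χ i) ∣ q i ∣) ⟩
  ∑[ i < m ] (χ i * (δ (h zero) i + ∣ q i ∣))
    ≡⟨ sum-cong-≗ (λ i → cong (χ i *_) (sym (∣b∷p∣≡𝟙b+∣p∣ (does (h zero ≟ᶠ i)) (q i)))) ⟩
  ∑[ i < m ] (χ i * ∣ does (h zero ≟ᶠ i) ∷ q i ∣) ∎
  where
  open ≡-Reasoning
  χ : Fin m → ℕ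
  χ i = δ (f i) γ
  q : Fin m → Subset _
  q i = p ∩ fibre (h ∘ suc) i
  distribute : ∀ a b r → a * b + b * r ≡ b * (a + r)
  distribute a b r = trans (cong (_+ b * r) (*-comm a b)) (sym (*-distribˡ-+ b a r))

∣p∣≡∑∣p∩fibre∣ : ∀ {n m} (p : Subset n) (h : Fin n → Fin m) → ∣ p ∣ ≡ ∑[ i < m ] ∣ p ∩ fibre h i ∣
∣p∣≡∑∣p∩fibre∣ {n} p h = begin
  ∣ p ∣                              ≡⟨ cong ∣_∣ (sym p∩⊤≡p) ⟩
  ∣ p ∩ fibre (const₀ ∘ h) zero ∣    ≡⟨ ∣p∩fibre[f∘h]∣≡∑ p h const₀ zero ⟩
  ∑[ i < _ ] (1 * ∣ p ∩ fibre h i ∣) ≡⟨ sum-cong-≗ (λ i → *-identityˡ ∣ p ∩ fibre h i ∣) ⟩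
  ∑[ i < _ ] ∣ p ∩ fibre h i ∣       ∎
  where
  open ≡-Reasoning
  const₀ : ∀ {m} → Fin m → Fin 1
  const₀ _ = zero
  fibre-const : ∀ n → fibre {n} const₀ zero ≡ ⊤
  fibre-const zero    = refl
  fibre-const (suc n) = cong (inside ∷_) (fibre-const n)
  p∩⊤≡p : p ∩ fibre (const₀ ∘ h) zero ≡ p
  p∩⊤≡p = trans (cong (p ∩_) (fibre-const n)) (∩-identityʳ p)

∣p∩fibre[f∘h]∣≡∣fibre∣ : ∀ {n m l} {p : Subset n} {h : Fin n → Fin m} (f : Fin m → Fin l) →
  (∀ i → ∣ p ∩ fibre h i ∣ ≡ 1) → ∀ γ → ∣ p ∩ fibre (f ∘ h) γ ∣ ≡ ∣ fibre f γ ∣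
∣p∩fibre[f∘h]∣≡∣fibre∣ {p = p} {h} f meets-once γ = begin
  ∣ p ∩ fibre (f ∘ h) γ ∣                    ≡⟨ ∣p∩fibre[f∘h]∣≡∑ p h f γ ⟩
  ∑[ i < _ ] (δ (f i) γ * ∣ p ∩ fibre h i ∣) ≡⟨ sum-cong-≗ (λ i → cong (δ (f i) γ *_) (meets-once i)) ⟩
  ∑[ i < _ ] (δ (f i) γ * 1)                 ≡⟨ sum-cong-≗ (λ i → *-identityʳ (δ (f i) γ)) ⟩
  ∑[ i < _ ] δ (f i) γ                       ≡⟨ sym (∣fibre∣≡∑ f γ) ⟩
  ∣ fibre f γ ∣                              ∎
  where open ≡-Reasoning

module _ (c : ℕ) .{{_ : NonZero c}} where

  suc[n/c]≤⌈n/c⌉ : ∀ n → 0 < n % c → suc (n / c) ≤ ⌈ n / c ⌉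
  suc[n/c]≤⌈n/c⌉ n 0<n%c = begin
    suc (n / c)                 ≡⟨ sym (m*n/n≡m (suc (n / c)) c) ⟩
    (c + n / c * c) / c         ≤⟨ /-monoˡ-≤ c c+q*c≤n+[c∸1] ⟩
    (n + (c ∸ 1)) / c           ∎
    where
    open ≤-Reasoning
    c+q*c≤n+[c∸1] : c + n / c * c ≤ n + (c ∸ 1)
    c+q*c≤n+[c∸1] = begin
      c + n / c * c               ≡⟨ cong (_+ n / c * c) (sym (m∸n+n≡m (>-nonZero⁻¹ c))) ⟩
      (c ∸ 1) + 1 + n / c * c     ≤⟨ +-monoˡ-≤ (n / c * c) (+-monoʳ-≤ (c ∸ 1) 0<n%c) ⟩
      (c ∸ 1) + n % c + n / c * c ≡⟨ +-assoc (c ∸ 1) (n % c) (n / c * c) ⟩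
      (c ∸ 1) + (n % c + n / c * c) ≡⟨ cong ((c ∸ 1) +_) (sym (m≡m%n+[m/n]*n n c)) ⟩
      (c ∸ 1) + n                 ≡⟨ +-comm (c ∸ 1) n ⟩
      n + (c ∸ 1)                 ∎

  n/c+e≤⌈n/c⌉ : ∀ n e → e ≤ 1 → (e ≡ 1 → 0 < n % c) → n / c + e ≤ ⌈ n / c ⌉
  n/c+e≤⌈n/c⌉ n zero          _        _         =
    ≤-trans (≤-reflexive (+-identityʳ (n / c))) (/-monoˡ-≤ c (m≤m+n n (c ∸ 1)))
  n/c+e≤⌈n/c⌉ n (suc zero)    _        e≡1⇒0<n%c =
    ≤-trans (≤-reflexive (+-comm (n / c) 1)) (suc[n/c]≤⌈n/c⌉ n (e≡1⇒0<n%c refl))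
  n/c+e≤⌈n/c⌉ n (suc (suc _)) (s≤s ()) _

  residue : ∀ {n} → Fin n → Fin c
  residue i = toℕ i mod c

  mod-injective : ∀ {m n} → m < c → n < c → m mod c ≡ n mod c → m ≡ n
  mod-injective {m} {n} m<c n<c m≡n[mod] = begin
    m             ≡⟨ sym (m<n⇒m%n≡m m<c) ⟩
    m % c         ≡⟨ sym (toℕ-fromℕ< (m%n<n m c)) ⟩
    toℕ (m mod c) ≡⟨ cong toℕ m≡n[mod] ⟩
    toℕ (n mod c) ≡⟨ toℕ-fromℕ< (m%n<n n c) ⟩
    n % c         ≡⟨ m<n⇒m%n≡m n<c ⟩
    n             ∎
    where open ≡-Reasoning

  residue-injective : ∀ {n} → n ≤ c → ∀ {i j : Fin n} → residue i ≡ residue j → i ≡ j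
  residue-injective n≤c {i} {j} eq =
    toℕ-injective (mod-injective (≤-trans (toℕ<n i) n≤c) (≤-trans (toℕ<n j) n≤c) eq)

  residue-fixes-Fin-c : ∀ (i : Fin c) → residue i ≡ i
  residue-fixes-Fin-c i =
    toℕ-injective (trans (toℕ-fromℕ< (m%n<n (toℕ i) c)) (m<n⇒m%n≡m (toℕ<n i)))

  module _ (γ : Fin c) where

    occurrences : ℕ → ℕ
    occurrences n = ∣ fibre (residue {n}) γ ∣

    occurrences≤1 : ∀ {n} → n ≤ c → occurrences n ≤ 1
    occurrences≤1 n≤c = ∣p∣≤1 λ x∈ y∈ →
      residue-injective n≤c (trans (∈-fibre⁻ {f = residue} x∈) (sym (∈-fibre⁻ {f = residue} y∈)))

    occurrences-period : occurrences c ≡ 1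
    occurrences-period = ∣p∣≡1 (∈-fibre⁺ {f = residue} (residue-fixes-Fin-c γ))
      (λ y∈ → trans (sym (residue-fixes-Fin-c _)) (∈-fibre⁻ {f = residue} y∈))

    hit : ℕ → ℕ
    hit m = δ (m mod c) γ

    occurrences≡∑hit : ∀ n → occurrences n ≡ ∑[ i < n ] hit (toℕ i)
    occurrences≡∑hit n = ∣fibre∣≡∑ (residue {n}) γ

    hit-periodic : ∀ m → hit (c + m) ≡ hit m
    hit-periodic m = cong (λ r → δ r γ)
      (fromℕ<-cong _ _ (%-remove-+ˡ m (∣-refl {c})) (m%n<n (c + m) c) (m%n<n m c))

    occurrences-periodic : ∀ q s → occurrences (q * c + s) ≡ q + occurrences s
    occurrences-periodic zero    s = refl
    occurrences-periodic (suc q) s = begin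
      occurrences (c + q * c + s)
        ≡⟨ cong occurrences (+-assoc c (q * c) s) ⟩
      occurrences (c + (q * c + s))
        ≡⟨ occurrences≡∑hit (c + (q * c + s)) ⟩
      ∑[ i < c + (q * c + s) ] hit (toℕ i)
        ≡⟨ ∑-toℕ-+ c hit ⟩
      ∑[ i < c ] hit (toℕ i) + ∑[ j < q * c + s ] hit (c + toℕ j)
        ≡⟨ cong₂ _+_ (sym (occurrences≡∑hit c)) rest ⟩
      occurrences c + occurrences (q * c + s)
        ≡⟨ cong₂ _+_ occurrences-period (occurrences-periodic q s) ⟩
      suc q + occurrences s
        ∎
      where
      open ≡-Reasoning
      rest : ∑[ j < q * c + s ] hit (c + toℕ j) ≡ occurrences (q * c + s)
      rest = trans (sum-cong-≗ {q * c + s} (hit-periodic ∘ toℕ)) (sym (occurrences≡∑hit (q * c + s)))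

    occurrences-bounds : ∀ n → n / c ≤ occurrences n × occurrences n ≤ ⌈ n / c ⌉
    occurrences-bounds n =
        subst (n / c ≤_) (sym split) (m≤m+n (n / c) (occurrences (n % c)))
      , subst (_≤ ⌈ n / c ⌉) (sym split)
          (n/c+e≤⌈n/c⌉ n (occurrences (n % c)) (occurrences≤1 (m%n≤n n c)) (occurrences≡1⇒0< (n % c)))
      where
      split : occurrences n ≡ n / c + occurrences (n % c)
      split = trans (cong occurrences (trans (m≡m%n+[m/n]*n n c) (+-comm (n % c) _)))
                    (occurrences-periodic (n / c) (n % c))
      occurrences≡1⇒0< : ∀ s → occurrences s ≡ 1 → 0 < s
      occurrences≡1⇒0< (suc s) _ = s≤s z≤n

module _ {k g u} (D : GDD k g u) where
  open GDD D

  0<blocksThrough : ∀ {B} → B ∈ˡ blocks → ∀ {x y} → x ∈ B → y ∈ B → 0 < blocksThrough blocks x y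
  0<blocksThrough B∈blocks {x} {y} x∈B y∈B =
    ∈-length (∈-filter⁺ (λ B → (x ∈? B) ×-dec (y ∈? B)) B∈blocks (x∈B , y∈B))

  grp-injective-on-block : ∀ {B} → B ∈ˡ blocks → ∀ {x y} → x ∈ B → y ∈ B → grp x ≡ grp y → x ≡ y
  grp-injective-on-block B∈blocks {x} {y} x∈B y∈B same-group with x ≟ᶠ y
  ... | yes x≡y = x≡y
  ... | no  x≢y with pairs x y x≢y
  ...   | inj₁ (_ , no-block)           =
    ⊥-elim (<-irrefl refl (subst (0 <_) no-block (0<blocksThrough B∈blocks x∈B y∈B)))
  ...   | inj₂ (different-groups , _)   = ⊥-elim (different-groups same-group)

  ∣B∩group∣≤1 : ∀ {B} → B ∈ˡ blocks → ∀ i → ∣ B ∩ fibre grp i ∣ ≤ 1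
  ∣B∩group∣≤1 B∈blocks = ∣p∩fibre∣≤1 (grp-injective-on-block B∈blocks)

  k≤u : ∀ {B} → B ∈ˡ blocks → k ≤ u
  k≤u {B} B∈blocks = begin
    k                              ≡⟨ sym (blockSize B B∈blocks) ⟩
    ∣ B ∣                          ≡⟨ ∣p∣≡∑∣p∩fibre∣ B grp ⟩
    ∑[ i < u ] ∣ B ∩ fibre grp i ∣ ≤⟨ ∑≤n (λ i → ∣ B ∩ fibre grp i ∣) (∣B∩group∣≤1 B∈blocks) ⟩
    u                              ∎
    where open ≤-Reasoning

  k≡u⇒∣B∩group∣≡1 : k ≡ u → ∀ {B} → B ∈ˡ blocks → ∀ i → ∣ B ∩ fibre grp i ∣ ≡ 1
  k≡u⇒∣B∩group∣≡1 k≡u {B} B∈blocks = ∑≡n⇒≡1 (λ i → ∣ B ∩ fibre grp i ∣) (∣B∩group∣≤1 B∈blocks)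
    (trans (sym (∣p∣≡∑∣p∩fibre∣ B grp)) (trans (blockSize B B∈blocks) k≡u))

  module _ (c : ℕ) .{{_ : NonZero c}} where

    colouring : Fin (u * g) → Fin c
    colouring = residue c ∘ grp

    k≡u⇒equitable : k ≡ u → BlockEquitable D c colouring
    k≡u⇒equitable k≡u B B∈blocks γ =
      subst (λ t → t / c ≤ N × N ≤ ⌈ t / c ⌉) (sym k≡u)
        (subst (λ n → u / c ≤ n × n ≤ ⌈ u / c ⌉) (sym N≡occurrences) (occurrences-bounds c γ u))
      where
      N : ℕ
      N = ∣ B ∩ fibre colouring γ ∣
      N≡occurrences : N ≡ occurrences c γ u
      N≡occurrences = ∣p∩fibre[f∘h]∣≡∣fibre∣ {p = B} {h = grp} (residue c)
                        (k≡u⇒∣B∩group∣≡1 k≡u B∈blocks) γ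

    u≤c⇒k<c⇒equitable : u ≤ c → k < c → BlockEquitable D c colouring
    u≤c⇒k<c⇒equitable u≤c k<c B B∈blocks γ = lower , upper
      where
      N : ℕ
      N = ∣ B ∩ fibre colouring γ ∣
      N≤1 : N ≤ 1
      N≤1 = ∣p∩fibre∣≤1 (λ x∈B y∈B same-colour →
        grp-injective-on-block B∈blocks x∈B y∈B (residue-injective c u≤c same-colour)) γ
      N≤k : N ≤ k
      N≤k = subst (N ≤_) (blockSize B B∈blocks) (∣p∩q∣≤∣p∣ B (fibre colouring γ))
      lower : k / c ≤ N
      lower = subst (_≤ N) (sym (m<n⇒m/n≡0 k<c)) z≤n
      upper : N ≤ ⌈ k / c ⌉
      upper = subst (λ q → q + N ≤ ⌈ k / c ⌉) (m<n⇒m/n≡0 k<c)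
        (n/c+e≤⌈n/c⌉ c k N N≤1 λ N≡1 → subst (0 <_) (sym (m<n⇒m%n≡m k<c)) (subst (_≤ k) N≡1 N≤k))

lemma2p4 : (k g u : ℕ) (D : GDD k g u) (c : ℕ) .{{nz : NonZero c}} → 2 ≤ c →
    ((c ≤ u * g × u ≤ c) ⊎ k ≡ u) →
    Σ (Fin (u * g) → Fin c) (λ f → BlockEquitable D c f)
lemma2p4 k g u D c _ (inj₂ k≡u)        = colouring D c , k≡u⇒equitable D c k≡u
lemma2p4 k g u D c _ (inj₁ (_ , u≤c)) with k <? c
... | yes k<c = colouring D c , u≤c⇒k<c⇒equitable D c u≤c k<c
... | no  k≮c = colouring D c , λ B B∈blocks →
  k≡u⇒equitable D c (≤-antisym (k≤u D B∈blocks) (≤-trans u≤c (≮⇒≥ k≮c))) B B∈blocks
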